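{- Let $G$ be a connected self-contained graph with $\mathrm{Fnd}(G) \neq \emptyset$. If $\mathrm{Fnd}(G)$ is a finite graph, then it contains a vertex $v$ which has infinite degree in $G$.
   Context: All graphs are simple; $\emptyset$ denotes the null graph (no vertices). A self-contained graph is an infinite graph which is isomorphic to one of its proper induced subgraphs. For an induced subgraph $H$ of $G$, $G \setminus H$ denotes $G[V(G)\setminus V(H)]$. For a self-contained graph $G$, a removable subgraph of $G$ is a proper induced subgraph $H$ of $G$ with $V(H)\neq\emptyset$ such that $G\setminus H \cong G$; $\mathrm{Rem}(G)$ is the set of removable subgraphs. The foundation $\mathrm{Fnd}(G)=\bigcap_{H\in\mathrm{Rem}(G)} G\setminus H$ is the induced subgraph of $G$ on the vertices lying in no removable subgraph of $G$. -}

module Defs where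

open import Data.Bool using (Bool; true; false; T; not)
open import Data.Product using (Σ; ∃; ∃-syntax; _×_; _,_; proj₁)
open import Data.List using (List)
open import Data.List.Membership.Propositional using (_∈_)
open import Data.Empty using (⊥)
open import Relation.Nullary using (¬_)
open import Relation.Binary.PropositionalEquality using (_≡_)
open import Function.Bundles using (_⤖_; _⇔_; Bijection)

record Graph : Set₁ where
  field
    V     : Set
    Adj   : V → V → Set
    sym   : ∀ {u v} → Adj u v → Adj v u
    irrefl : ∀ {v} → ¬ Adj v v
open Graph public

Finite : Set → Set
Finite A = ∃[ xs ] (∀ (a : A) → a ∈ xs)

FinitePred : {A : Set} → (A → Set) → Set
FinitePred {A} P = ∃[ xs ] (∀ (a : A) → P a → a ∈ xs)

Infinite : Set → Set
Infinite A = ¬ Finite A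

-- Vertex subsets are Boolean-valued predicates (classically all subsets are).
Subset : Graph → Set
Subset G = V G → Bool

induced : (G : Graph) → Subset G → Graph
induced G S = record
  { V = Σ (V G) (λ v → T (S v))
  ; Adj = λ u w → Adj G (proj₁ u) (proj₁ w)
  ; sym = sym G
  ; irrefl = irrefl G
  }

-- complement of a subset, so  G ∖ H  is  induced G (compl S)
compl : {G : Graph} → Subset G → Subset G
compl S v = not (S v)

record _≅_ (G H : Graph) : Set where
  field
    bij : V G ⤖ V H
    adj : ∀ u w → Adj G u w ⇔ Adj H (Bijection.to bij u) (Bijection.to bij w)

Proper : {G : Graph} → Subset G → Set
Proper {G} S = ∃[ v ] (S v ≡ false)

Nonempty : {G : Graph} → Subset G → Set
Nonempty {G} S = ∃[ v ] (S v ≡ true)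

SelfContained : Graph → Set
SelfContained G = Infinite (V G) × ∃[ S ] (Proper {G} S × (G ≅ induced G S))

Removable : (G : Graph) → Subset G → Set
Removable G S = Proper {G} S × Nonempty {G} S × (induced G (compl {G} S) ≅ G)

InFnd : (G : Graph) → V G → Set
InFnd G v = ∀ (S : Subset G) → Removable G S → S v ≡ false

data Walk (G : Graph) : V G → V G → Set where
  here : ∀ {v} → Walk G v v
  step : ∀ {u w v} → Adj G u w → Walk G w v → Walk G u v

Connected : Graph → Set
Connected G = ∀ (u v : V G) → Walk G u v

InfiniteDegree : (G : Graph) → V G → Set
InfiniteDegree G v = ¬ FinitePred (Adj G v)

module Submission where

-- Removable subgraphs correspond to non-surjective self-embeddings θ
-- of G (isomorphisms of G onto an induced subgraph), the removed part being
-- the complement of the image; hence Fnd(G) is exactly the set of vertices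
-- lying in the image of every such θ.  Fnd(G) is closed under θ-preimages,
-- and since it is finite, a pigeonhole argument shows it is closed under θ
-- as well.  If every vertex of Fnd(G) had finite degree, the set of edges
-- leaving Fnd(G) would be finite and mapped injectively into itself by θ,
-- so by pigeonhole again every neighbour of Fnd(G) lies in the image of
-- every θ, i.e. in Fnd(G).  By connectedness Fnd(G) would then be all of
-- G, contradicting that G is infinite.

open import Defs hiding (sym)
open import Level using (0ℓ)
open import Axiom.ExcludedMiddle using (ExcludedMiddle)
open import Data.Product using (∃-syntax; _×_; Σ; _,_; proj₁; proj₂)
open import Data.Bool using (true; false; T)
open import Data.Bool.Properties using (T-irrelevant; T-≡; T-not-≡)
open import Data.Empty using (⊥-elim)
open import Data.Maybe using (Maybe; just; nothing)
import Data.Maybe.Relation.Unary.Any as MaybeAny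
open import Data.Nat using (zero; suc; _≤_; _<_; z≤n; s≤s)
open import Data.Nat.Properties using (≤-trans; <-≤-trans; n≮n)
open import Data.List using (List; []; length; map; filter; mapMaybe; concatMap)
open import Data.List.Properties using (filter-notAll; length-mapMaybe)
import Data.List.Relation.Unary.Any as Any
open import Data.List.Relation.Unary.Any.Properties using (mapMaybe⁺; map⁺)
open import Data.List.Membership.Propositional using (_∈_)
open import Data.List.Membership.Propositional.Properties using (∈-filter⁺; ∈-map⁺; ∈-concatMap⁺)
open import Relation.Nullary using (¬_; Dec; yes; no)
open import Relation.Nullary.Decidable using (decidable-stable; ⌊_⌋; fromWitness; toWitnessFalse; fromWitnessFalse)
open import Relation.Binary.PropositionalEquality using (_≡_; _≢_; refl; sym; trans; cong; cong₂; subst; subst₂; module ≡-Reasoning)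
open import Function.Bundles using (Equivalence; Inverse; mk⇔; mk↔ₛ′)
open import Function.Properties.Bijection using (⤖⇒↔)
open import Function.Properties.Inverse using (↔⇒⤖)

Covers : {A : Set} → (A → Set) → List A → Set
Covers P xs = ∀ a → P a → a ∈ xs

InjectiveOn : {A B : Set} → (A → Set) → (A → B) → Set
InjectiveOn P h = ∀ a b → P a → P b → h a ≡ h b → a ≡ b

module Pigeonhole (em : ExcludedMiddle 0ℓ) where

  cover-delete : ∀ {A : Set} {Q : A → Set} {ys} → Covers Q ys → ∀ {y} → Q y →
                 ∃[ zs ] (length zs < length ys × Covers (λ b → Q b × b ≢ y) zs)
  cover-delete {ys = ys} cov {y} qy =
      filter other? ys
    , filter-notAll other? ys (Any.map (λ y≡b b≢y → b≢y (sym y≡b)) (cov y qy))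
    , λ b (qb , b≢y) → ∈-filter⁺ other? (cov b qb) b≢y
    where
      other? : ∀ b → Dec (b ≢ y)
      other? b = em

  -- If h maps P injectively into Q, a cover of Q yields a cover of P that
  -- is no longer: keep a chosen P-preimage of every element of the cover.
  cover-pullback : ∀ {A B : Set} {P : A → Set} {Q : B → Set} (h : A → B) →
                   (∀ a → P a → Q (h a)) → InjectiveOn P h →
                   ∀ {ys} → Covers Q ys → ∃[ zs ] (length zs ≤ length ys × Covers P zs)
  cover-pullback {A} {B} {P} h maps inj {ys} cov =
    mapMaybe preimage ys , length-mapMaybe preimage ys , covers
    where
      preimage : B → Maybe A
      preimage b with em {∃[ a ] (P a × h a ≡ b)}
      ... | yes (a , _) = just a
      ... | no _        = nothing

      preimage-h : ∀ a → P a → preimage (h a) ≡ just a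
      preimage-h a pa with em {∃[ a′ ] (P a′ × h a′ ≡ h a)}
      ... | yes (a′ , pa′ , e) = cong just (inj a′ a pa′ pa e)
      ... | no none            = ⊥-elim (none (a , pa , refl))

      covers : Covers P (mapMaybe preimage ys)
      covers a pa = mapMaybe⁺ preimage ys (map⁺ (Any.map found (cov (h a) (maps a pa))))
        where
          found : ∀ {b} → h a ≡ b → MaybeAny.Any (a ≡_) (preimage b)
          found refl = subst (MaybeAny.Any (a ≡_)) (sym (preimage-h a pa)) (MaybeAny.just refl)

  cover-shrink : ∀ {A : Set} {P : A → Set} (h : A → A) →
                 (∀ a → P a → P (h a)) → InjectiveOn P h →
                 ∀ {y} → P y → (∀ a → P a → h a ≢ y) →
                 ∀ {xs} → Covers P xs → ∃[ zs ] (length zs < length xs × Covers P zs)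
  cover-shrink h maps inj py misses cov
    with ys , ys<xs , ys-cov ← cover-delete cov py
    with zs , zs≤ys , zs-cov ← cover-pullback h (λ a pa → maps a pa , misses a pa) inj ys-cov
    = zs , <-≤-trans (s≤s zs≤ys) ys<xs , zs-cov

  covers-unbounded : ∀ {A : Set} {P : A → Set} (h : A → A) →
                     (∀ a → P a → P (h a)) → InjectiveOn P h →
                     ∀ {y} → P y → (∀ a → P a → h a ≢ y) →
                     ∀ n {xs} → Covers P xs → n ≤ length xs
  covers-unbounded h maps inj py misses zero    cov = z≤n
  covers-unbounded h maps inj py misses (suc n) cov
    with zs , zs<xs , zs-cov ← cover-shrink h maps inj py misses cov
    = ≤-trans (s≤s (covers-unbounded h maps inj py misses n zs-cov)) zs<xs

  pigeonhole : ∀ {A : Set} {P : A → Set} (h : A → A) →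
               (∀ a → P a → P (h a)) → InjectiveOn P h → FinitePred P →
               ∀ y → P y → ∃[ a ] (P a × h a ≡ y)
  pigeonhole h maps inj (xs , cov) y py = decidable-stable em λ no-preimage →
    n≮n (length xs) (covers-unbounded h maps inj py
                       (λ a pa e → no-preimage (a , pa , e)) (suc (length xs)) cov)

  finite-Σ : ∀ {A B : Set} {P : A → Set} {Q : A → B → Set} →
             FinitePred P → (∀ a → P a → FinitePred (Q a)) →
             FinitePred (λ (p : A × B) → P (proj₁ p) × Q (proj₁ p) (proj₂ p))
  finite-Σ {A} {B} {P} {Q} (xs , cov) fibre-finite =
    concatMap fibre xs , λ (a , b) (pa , qab) → ∈-concatMap⁺ fibre (Any.map (in-fibre pa qab) (cov a pa))
    where
      fibreOf : ∀ a → Dec (P a) → List (A × B)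
      fibreOf a (yes pa) = map (a ,_) (proj₁ (fibre-finite a pa))
      fibreOf a (no _)   = []

      fibre : A → List (A × B)
      fibre a = fibreOf a em

      in-fibre : ∀ {a b} → P a → Q a b → ∀ {a′} → a ≡ a′ → (a , b) ∈ fibre a′
      in-fibre {a} {b} pa qab refl with em {P a}
      ... | yes pa′ = ∈-map⁺ (a ,_) (proj₂ (fibre-finite a pa′) b qab)
      ... | no ¬pa  = ⊥-elim (¬pa pa)

induced-vertex-≡ : (G : Graph) (S : Subset G) {x y : V (induced G S)} →
                   proj₁ x ≡ proj₁ y → x ≡ y
induced-vertex-≡ G S {v , p} {.v , q} refl = cong (v ,_) (T-irrelevant p q)

module SelfEmbeddings (em : ExcludedMiddle 0ℓ) (G : Graph) where

  record Embedding : Set where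
    field
      emb       : V G → V G
      injective : ∀ {a b} → emb a ≡ emb b → a ≡ b
      preserves : ∀ {a b} → Adj G a b → Adj G (emb a) (emb b)
      reflects  : ∀ {a b} → Adj G (emb a) (emb b) → Adj G a b
      missed    : V G
      misses    : ∀ u → emb u ≢ missed
  open Embedding

  Image : Embedding → V G → Set
  Image θ v = ∃[ u ] (emb θ u ≡ v)

  _∘ₑ_ : Embedding → Embedding → Embedding
  θ ∘ₑ θ′ = record
    { emb       = λ u → emb θ (emb θ′ u)
    ; injective = λ e → injective θ′ (injective θ e)
    ; preserves = λ a → preserves θ (preserves θ′ a)
    ; reflects  = λ a → reflects θ′ (reflects θ a)
    ; missed    = missed θ
    ; misses    = λ u → misses θ (emb θ′ u)
    }

  -- Removing a removable subgraph G[R] leaves a copy of G; the inverse of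
  -- that isomorphism is a self-embedding whose image avoids R.
  removable⇒embedding : ∀ R → Removable G R →
                        Σ Embedding (λ θ → ∀ v → Image θ v → R v ≡ false)
  removable⇒embedding R (_ , (w , Rw≡true) , iso) = θ , image-avoids-R
    where
      open Inverse (⤖⇒↔ (_≅_.bij iso))
      outside : V G → V G
      outside y = proj₁ (from y)

      outside∉R : ∀ y → R (outside y) ≡ false
      outside∉R y = Equivalence.to T-not-≡ (proj₂ (from y))

      back : ∀ y → to (from y) ≡ y
      back = strictlyInverseˡ

      θ : Embedding
      θ = record
        { emb       = outside
        ; injective = λ {a} {b} e → begin
            a             ≡⟨ sym (back a) ⟩
            to (from a)   ≡⟨ cong to (induced-vertex-≡ G (compl {G} R) e) ⟩
            to (from b)   ≡⟨ back b ⟩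
            b             ∎
        ; preserves = λ {a} {b} ab →
            Equivalence.from (_≅_.adj iso (from a) (from b)) (subst₂ (Adj G) (sym (back a)) (sym (back b)) ab)
        ; reflects  = λ {a} {b} ab →
            subst₂ (Adj G) (back a) (back b) (Equivalence.to (_≅_.adj iso (from a) (from b)) ab)
        ; missed    = w
        ; misses    = λ u e → true≢false (trans (sym Rw≡true) (trans (cong R (sym e)) (outside∉R u)))
        }
        where
          open ≡-Reasoning
          true≢false : true ≢ false
          true≢false ()

      image-avoids-R : ∀ v → Image θ v → R v ≡ false
      image-avoids-R v (u , refl) = outside∉R u

  -- Conversely the complement of the image of a self-embedding is
  -- removable: G minus it is the image, a copy of G.
  embedding⇒removable : (θ : Embedding) →
                        Σ (Subset G) (λ R → Removable G R × (∀ v → R v ≡ false → Image θ v))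
  embedding⇒removable θ = R , (proper , nonempty , iso) , outside-R-is-image
    where
      R : Subset G
      R v = ⌊ em {¬ Image θ v} ⌋

      from-compl : ∀ {v} → T (compl {G} R v) → Image θ v
      from-compl t = decidable-stable em (toWitnessFalse t)

      to-compl : ∀ {v} → Image θ v → T (compl {G} R v)
      to-compl img = fromWitnessFalse (λ ¬img → ¬img img)

      outside-R-is-image : ∀ v → R v ≡ false → Image θ v
      outside-R-is-image v e = from-compl (Equivalence.from T-not-≡ e)

      proper : Proper {G} R
      proper = emb θ (missed θ) , Equivalence.to T-not-≡ (to-compl (missed θ , refl))

      nonempty : Nonempty {G} R
      nonempty = missed θ , Equivalence.to T-≡ (fromWitness λ { (u , e) → misses θ u e })

      H : Graph
      H = induced G (compl {G} R)

      preimage : V H → V G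
      preimage (v , t) = proj₁ (from-compl t)

      emb-preimage : ∀ x → emb θ (preimage x) ≡ proj₁ x
      emb-preimage (v , t) = proj₂ (from-compl t)

      inclusion : V G → V H
      inclusion u = emb θ u , to-compl (u , refl)

      iso : H ≅ G
      iso = record
        { bij = ↔⇒⤖ (mk↔ₛ′ preimage inclusion
                  (λ u → injective θ (emb-preimage (inclusion u)))
                  (λ x → induced-vertex-≡ G (compl {G} R) (emb-preimage x)))
        ; adj = λ x y → mk⇔
            (λ xy → reflects θ (subst₂ (Adj G) (sym (emb-preimage x)) (sym (emb-preimage y)) xy))
            (λ xy → subst₂ (Adj G) (emb-preimage x) (emb-preimage y) (preserves θ xy))
        }

  fnd⇒image : ∀ {v} → InFnd G v → ∀ θ → Image θ v
  fnd⇒image {v} v∈Fnd θ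
    with R , R-removable , outside-R-is-image ← embedding⇒removable θ
    = outside-R-is-image v (v∈Fnd R R-removable)

  image⇒fnd : ∀ {v} → (∀ θ → Image θ v) → InFnd G v
  image⇒fnd {v} in-images R R-removable
    with θ , image-avoids-R ← removable⇒embedding R R-removable
    = image-avoids-R v (in-images θ)

  -- Fnd(G) is closed under preimages: if θ w ∈ Fnd(G) then, for every θ′,
  -- θ w = θ (θ′ x) for some x, whence w = θ′ x by injectivity.
  fnd-preimage-closed : ∀ θ {w} → InFnd G (emb θ w) → InFnd G w
  fnd-preimage-closed θ θw∈Fnd = image⇒fnd λ θ′ →
    let (x , e) = fnd⇒image θw∈Fnd (θ ∘ₑ θ′) in x , injective θ e

  -- A chosen preimage of a vertex (arbitrary outside the image).
  preimage : Embedding → V G → V G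
  preimage θ v with em {Image θ v}
  ... | yes (u , _) = u
  ... | no _        = v

  emb-preimage : ∀ θ {v} → Image θ v → emb θ (preimage θ v) ≡ v
  emb-preimage θ {v} img with em {Image θ v}
  ... | yes (_ , e) = e
  ... | no ¬img     = ⊥-elim (¬img img)

  module FiniteFoundation (fnd-finite : FinitePred (InFnd G)) where
    open Pigeonhole em

    preimage-maps-fnd : ∀ θ a → InFnd G a → InFnd G (preimage θ a)
    preimage-maps-fnd θ a a∈Fnd =
      fnd-preimage-closed θ (subst (InFnd G) (sym (emb-preimage θ (fnd⇒image a∈Fnd θ))) a∈Fnd)

    preimage-injective : ∀ θ → InjectiveOn (InFnd G) (preimage θ)
    preimage-injective θ a b a∈Fnd b∈Fnd e = begin
      a                    ≡⟨ sym (emb-preimage θ (fnd⇒image a∈Fnd θ)) ⟩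
      emb θ (preimage θ a) ≡⟨ cong (emb θ) e ⟩
      emb θ (preimage θ b) ≡⟨ emb-preimage θ (fnd⇒image b∈Fnd θ) ⟩
      b                    ∎
      where open ≡-Reasoning

    -- By pigeonhole, taking preimages is onto Fnd(G): each v ∈ Fnd(G) is
    -- the preimage of some a ∈ Fnd(G), so θ v = a ∈ Fnd(G).
    fnd-image-closed : ∀ θ {v} → InFnd G v → InFnd G (emb θ v)
    fnd-image-closed θ {v} v∈Fnd
      with a , a∈Fnd , pre-a≡v ← pigeonhole (preimage θ) (preimage-maps-fnd θ)
                                   (preimage-injective θ) fnd-finite v v∈Fnd
      = subst (InFnd G) (trans (sym (emb-preimage θ (fnd⇒image a∈Fnd θ))) (cong (emb θ) pre-a≡v)) a∈Fnd

    FndEdge : V G × V G → Set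
    FndEdge (v , u) = InFnd G v × Adj G v u

    -- If all vertices of Fnd(G) have finite degree, θ × θ is an injective
    -- self-map of the finite set of such edges, hence onto it: every
    -- neighbour of Fnd(G) lies in the image of θ, and thus in Fnd(G).
    fnd-adjacency-closed : (∀ v → InFnd G v → FinitePred (Adj G v)) →
                           ∀ {v u} → InFnd G v → Adj G v u → InFnd G u
    fnd-adjacency-closed finite-degree {v} {u} v∈Fnd vu = image⇒fnd λ θ →
      let (_ , y) , _ , e = pigeonhole (θ×θ θ) (edge-maps θ) (edge-injective θ)
                              (finite-Σ fnd-finite finite-degree) (v , u) (v∈Fnd , vu)
      in y , cong proj₂ e
      where
        θ×θ : Embedding → V G × V G → V G × V G
        θ×θ θ (x , y) = emb θ x , emb θ y

        edge-maps : ∀ θ p → FndEdge p → FndEdge (θ×θ θ p)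
        edge-maps θ _ (x∈Fnd , xy) = fnd-image-closed θ x∈Fnd , preserves θ xy

        edge-injective : ∀ θ → InjectiveOn FndEdge (θ×θ θ)
        edge-injective θ _ _ _ _ e = cong₂ _,_ (injective θ (cong proj₁ e)) (injective θ (cong proj₂ e))

    fnd-walk-closed : (∀ v → InFnd G v → FinitePred (Adj G v)) →
                      ∀ {v w} → InFnd G v → Walk G v w → InFnd G w
    fnd-walk-closed finite-degree v∈Fnd here         = v∈Fnd
    fnd-walk-closed finite-degree v∈Fnd (step vu uw) =
      fnd-walk-closed finite-degree (fnd-adjacency-closed finite-degree v∈Fnd vu) uw

-- If no vertex of Fnd(G) had infinite degree, Fnd(G) would be closed under
-- walks, so by connectedness it would contain (and its finite cover would
-- list) every vertex of the infinite graph G.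
corollary3p2 : ExcludedMiddle 0ℓ → (G : Graph) → Connected G → SelfContained G →
    ∃[ v ] InFnd G v → FinitePred (InFnd G) →
    ∃[ v ] (InFnd G v × InfiniteDegree G v)
corollary3p2 em G connected (G-infinite , _) (v₀ , v₀∈Fnd) fnd-finite@(fnd-list , fnd-cover) =
  decidable-stable em λ no-infinite-degree →
    let finite-degree : ∀ v → InFnd G v → FinitePred (Adj G v)
        finite-degree v v∈Fnd = decidable-stable em λ infinite → no-infinite-degree (v , v∈Fnd , infinite)
    in G-infinite (fnd-list , λ w → fnd-cover w (fnd-walk-closed finite-degree v₀∈Fnd (connected v₀ w)))
  where open SelfEmbeddings.FiniteFoundation em G fnd-finite
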